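{- $\mathrm{tree}(3) \geq 844{,}424{,}930{,}131{,}960 = 3 \cdot 2^{48} - 8$. That is, there exists a sequence $(T_1, T_2, \ldots, T_m)$ of unlabeled finite rooted trees with $m \geq 3 \cdot 2^{48} - 8$ such that for each $k$ the tree $T_k$ has at most $k+3$ vertices, and for all $i < j$ there is no inf-embedding of $T_i$ into $T_j$.
   Context: A rooted tree is a finite connected acyclic graph $T=(V,E)$ with a distinguished vertex $r$, the root. A vertex $v$ is a descendant of $u$ if $u$ lies on the unique path from $r$ to $v$; $v$ is a child of $u$ if $v$ is a descendant of $u$ and $(u,v)\in E$. For vertices $u,v$, the infimum $\inf(u,v)$ is the unique vertex $w$ that is an ancestor of both $u$ and $v$ such that no descendant of $w$ (other than $w$) has this property (the least common ancestor). For rooted trees $T_1=(V_1,E_1,r_1)$ and $T_2=(V_2,E_2,r_2)$, an inf-embedding is an injective map $f:V_1\to V_2$ such that (i) if $v$ is a descendant of $u$ in $T_1$ then $f(v)$ is a descendant of $f(u)$ in $T_2$, and (ii) $f(\inf_{T_1}(u,v)) = \inf_{T_2}(f(u),f(v))$ for all $u,v\in V_1$; write $T_1\leq T_2$ if one exists. The weak tree function $\mathrm{tree}(n)$ is the length of the longest sequence $(T_1,\ldots,T_m)$ of unlabeled rooted trees such that each $T_k$ has at most $k+n$ vertices and $T_i \not\leq T_j$ for all $i<j$. -}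

module Defs where

open import Data.Nat using (ℕ; zero; suc; _+_; _≤_)
open import Data.Fin using (Fin)
open import Data.List using (List; []; _∷_; length; lookup)
open import Data.Product using (_×_; Σ)
open import Relation.Binary.PropositionalEquality using (_≡_)
open import Function.Definitions using (Injective)

-- Children are stored in a list, but
-- every notion below (vertex count, inf-embedding) is invariant under
-- reordering children, so these represent unlabeled rooted trees.
data Tree : Set where
  node : List Tree → Tree

mutual
  size : Tree → ℕ
  size (node ts) = suc (sizes ts)

  sizes : List Tree → ℕ
  sizes []       = zero
  sizes (t ∷ ts) = size t + sizes ts

data Vertex : Tree → Set where
  root  : ∀ {ts} → Vertex (node ts)
  child : ∀ {ts} (i : Fin (length ts)) → Vertex (lookup ts i) → Vertex (node ts)

data _≼_ : {t : Tree} → Vertex t → Vertex t → Set where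
  root≼  : ∀ {ts} {v : Vertex (node ts)} → root ≼ v
  child≼ : ∀ {ts} {i : Fin (length ts)} {u v : Vertex (lookup ts i)} →
           _≼_ {lookup ts i} u v → _≼_ {node ts} (child i u) (child i v)

IsInf : {t : Tree} → Vertex t → Vertex t → Vertex t → Set
IsInf u v w = (w ≼ u) × (w ≼ v) ×
              (∀ w′ → w′ ≼ u → w′ ≼ v → w ≼ w′ → w′ ≡ w)

record InfEmbedding (T₁ T₂ : Tree) : Set where
  field
    f         : Vertex T₁ → Vertex T₂
    injective : Injective _≡_ _≡_ f
    mono      : ∀ {u v} → u ≼ v → f u ≼ f v
    pres-inf  : ∀ {u v w} → IsInf u v w → IsInf (f u) (f v) (f w)

_≤ᵗ_ : Tree → Tree → Set
T₁ ≤ᵗ T₂ = InfEmbedding T₁ T₂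

{-# OPTIONS --safe #-}
-- After the claw every tree is binary, and after the double fork every tree has all its branch
-- points on one level.  The remaining trees are the trees yTree p b e (a stem of length p above a
-- fork with arms b + e and b) in decreasing lexicographic order of (p, b, e), then paths of
-- decreasing height.  An inf-embedding is injective, maps branch points to branch points and does
-- not shorten the depth difference between a vertex and its descendants, so no tree embeds into a
-- later one: the apex cannot rise (p), the shorter arm cannot shrink (b), the tree cannot become
-- shallower (e, paths).  For fixed (p, b) the block starts with the largest e that the size bound
-- allows at its position and counts down to e = 0, so a block is about as long as its starting
-- position; thus the position roughly doubles with every decrease of b, and the sequence has
-- length exactly 3·2^48 − 8.
module Submission where

open import Defs

module NonEmbedding where
  open import Data.Nat using (ℕ; zero; suc; _+_; _≤_; _<_; z≤n; s≤s)
  open import Data.Nat.Properties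
  open import Data.Fin using (Fin; zero; suc)
  open import Data.List using ([]; _∷_; length; lookup)
  open import Data.Product using (_×_; _,_; proj₁; proj₂; ∃-syntax)
  open import Data.Sum using (_⊎_; inj₁; inj₂; [_,_]′) renaming (map to ⊎-map)
  open import Data.Empty using (⊥; ⊥-elim)
  open import Function using (_∘_)
  open import Relation.Nullary using (¬_)
  open import Relation.Binary.PropositionalEquality

  depth : ∀ {t} → Vertex t → ℕ
  depth root        = 0
  depth (child _ v) = suc (depth v)

  -- The root of an arbitrary tree; the constructor root needs a tree of the form node ts.
  top : ∀ t → Vertex t
  top (node _) = root

  top≼ : ∀ t (v : Vertex t) → top t ≼ v
  top≼ (node _) _ = root≼

  child-injective : ∀ {ts} {i : Fin (length ts)} {u v : Vertex (lookup ts i)} →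
                    child {ts} i u ≡ child i v → u ≡ v
  child-injective refl = refl

  child≢root : ∀ {ts} {i : Fin (length ts)} {v : Vertex (lookup ts i)} → child {ts} i v ≢ root
  child≢root ()

  ≼∧≢⇒depth< : ∀ {t} {u v : Vertex t} → u ≼ v → u ≢ v → depth u < depth v
  ≼∧≢⇒depth< (root≼ {v = root})      u≢v = ⊥-elim (u≢v refl)
  ≼∧≢⇒depth< (root≼ {v = child _ _}) _   = s≤s z≤n
  ≼∧≢⇒depth< (child≼ u≼v)            u≢v = s≤s (≼∧≢⇒depth< u≼v (u≢v ∘ cong (child _)))

  inf-child : ∀ {ts} {i : Fin (length ts)} {x y w : Vertex (lookup ts i)} →
              IsInf x y w → IsInf (child {ts} i x) (child i y) (child i w)
  inf-child {ts} {i} {x} {y} {w} (w≼x , w≼y , greatest) = child≼ w≼x , child≼ w≼y , greatest′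
    where
      greatest′ : ∀ w′ → w′ ≼ child i x → w′ ≼ child i y → child i w ≼ w′ → w′ ≡ child i w
      greatest′ (child _ w′) (child≼ a) (child≼ b) (child≼ c) = cong (child i) (greatest w′ a b c)

  inf-root : ∀ {ts} {i j : Fin (length ts)} {x : Vertex (lookup ts i)} {y : Vertex (lookup ts j)} →
             i ≢ j → IsInf (child {ts} i x) (child j y) root
  inf-root {ts} {i} {j} {x} {y} i≢j = root≼ , root≼ , greatest
    where
      greatest : ∀ w′ → w′ ≼ child i x → w′ ≼ child j y → root ≼ w′ → w′ ≡ root
      greatest root        _          _          _ = refl
      greatest (child _ _) (child≼ _) (child≼ _) _ = ⊥-elim (i≢j refl)

  Branching : ∀ {t} → Vertex t → Vertex t → Vertex t → Set
  Branching w x y = IsInf x y w × x ≢ w × y ≢ w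

  branching-root : ∀ {ts} {i j : Fin (length ts)} {x : Vertex (lookup ts i)} {y : Vertex (lookup ts j)} →
                   i ≢ j → Branching root (child {ts} i x) (child j y)
  branching-root i≢j = inf-root i≢j , child≢root , child≢root

  branching-child : ∀ {ts} {i : Fin (length ts)} {w x y : Vertex (lookup ts i)} →
                    Branching w x y → Branching (child {ts} i w) (child i x) (child i y)
  branching-child (inf , x≢w , y≢w) = inf-child inf , x≢w ∘ child-injective , y≢w ∘ child-injective

  branching-at-root : ∀ {ts} {x y : Vertex (node ts)} → Branching root x y →
    ∃[ i ] ∃[ j ] ∃[ x′ ] ∃[ y′ ] x ≡ child i x′ × y ≡ child j y′ × i ≢ j
  branching-at-root {x = root}                       (_ , x≢root , _) = ⊥-elim (x≢root refl)
  branching-at-root {x = child _ _} {root}           (_ , _ , y≢root) = ⊥-elim (y≢root refl)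
  branching-at-root {x = child i x′} {child j y′} ((_ , _ , greatest) , _) =
    i , j , x′ , y′ , refl , refl , λ { refl →
      child≢root (greatest (child i (top _)) (child≼ (top≼ _ x′)) (child≼ (top≼ _ y′)) root≼) }

  branching-at-child : ∀ {ts} {i : Fin (length ts)} {w : Vertex (lookup ts i)} {x y : Vertex (node ts)} →
    Branching (child i w) x y → ∃[ x′ ] ∃[ y′ ] x ≡ child i x′ × y ≡ child i y′ × Branching w x′ y′
  branching-at-child ((child≼ w≼x , child≼ w≼y , greatest) , x≢w , y≢w) =
    _ , _ , refl , refl ,
    (w≼x , w≼y , λ w′ a b c → child-injective (greatest (child _ w′) (child≼ a) (child≼ b) (child≼ c))) ,
    x≢w ∘ cong (child _) , y≢w ∘ cong (child _)

  open InfEmbedding using (f)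

  branching-image : ∀ {t t′} (E : t ≤ᵗ t′) {w x y : Vertex t} →
                    Branching w x y → Branching (f E w) (f E x) (f E y)
  branching-image E (inf , x≢w , y≢w) = pres-inf inf , x≢w ∘ injective , y≢w ∘ injective
    where open InfEmbedding E using (injective; pres-inf)

  restrict : ∀ {ts t′} → node ts ≤ᵗ t′ → (i : Fin (length ts)) → lookup ts i ≤ᵗ t′
  restrict E i = record
    { f         = f E ∘ child i
    ; injective = λ eq → child-injective (injective eq)
    ; mono      = mono ∘ child≼
    ; pres-inf  = pres-inf ∘ inf-child
    }
    where open InfEmbedding E using (injective; mono; pres-inf)

  depth-root<child : ∀ {ts t′} (E : node ts ≤ᵗ t′) {i} (v : Vertex (lookup ts i)) →
                     depth (f E root) < depth (f E (child i v))
  depth-root<child E v = ≼∧≢⇒depth< (mono root≼) (child≢root ∘ sym ∘ injective)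
    where open InfEmbedding E using (injective; mono)

  depth-top-gap : ∀ {t t′} (E : t ≤ᵗ t′) (v : Vertex t) → depth (f E (top t)) + depth v ≤ depth (f E v)
  depth-top-gap E root        = ≤-reflexive (+-identityʳ _)
  depth-top-gap E (child i v) = begin
    depth (f E root) + suc (depth v)              ≡⟨ +-suc _ (depth v) ⟩
    suc (depth (f E root)) + depth v              ≤⟨ +-monoˡ-≤ (depth v) (depth-root<child E (top _)) ⟩
    depth (f E (child i (top _))) + depth v       ≤⟨ depth-top-gap (restrict E i) v ⟩
    depth (f E (child i v))                       ∎
    where open ≤-Reasoning

  depth-mono : ∀ {t t′} (E : t ≤ᵗ t′) (v : Vertex t) → depth v ≤ depth (f E v)
  depth-mono E v = ≤-trans (m≤n+m (depth v) _) (depth-top-gap E v)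

  depth-gap : ∀ {t t′} (E : t ≤ᵗ t′) {w x : Vertex t} {n} →
              w ≼ x → depth w + n ≤ depth x → depth (f E w) + n ≤ depth (f E x)
  depth-gap E {x = x} root≼ n≤x = ≤-trans (+-monoʳ-≤ _ n≤x) (depth-top-gap E x)
  depth-gap E (child≼ w≼x) (s≤s w+n≤x) = depth-gap (restrict E _) w≼x w+n≤x

  stick : ℕ → Tree → Tree
  stick zero    t = t
  stick (suc p) t = node (stick p t ∷ [])

  path : ℕ → Tree
  path h = stick h (node [])

  fork : ℕ → ℕ → Tree
  fork a b = node (path a ∷ path b ∷ [])

  yTree : ℕ → ℕ → ℕ → Tree
  yTree p b e = stick p (fork (b + e) b)

  claw : Tree
  claw = node (path 0 ∷ path 0 ∷ path 0 ∷ [])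

  doubleFork : Tree
  doubleFork = node (fork 0 0 ∷ path 0 ∷ [])

  lift : ∀ p {t} → Vertex t → Vertex (stick p t)
  lift zero    v = v
  lift (suc p) v = child zero (lift p v)

  depth-lift : ∀ p {t} (v : Vertex t) → depth (lift p v) ≡ p + depth v
  depth-lift zero    v = refl
  depth-lift (suc p) v = cong suc (depth-lift p v)

  branching-lift : ∀ p {t} {w x y : Vertex t} → Branching w x y → Branching (lift p w) (lift p x) (lift p y)
  branching-lift zero    br = br
  branching-lift (suc p) br = branching-child (branching-lift p br)

  branching-unlift : ∀ p {t} {w x y : Vertex (stick p t)} → Branching w x y →
    ∃[ w′ ] ∃[ x′ ] ∃[ y′ ] Branching {t} w′ x′ y′ × w ≡ lift p w′ × x ≡ lift p x′ × y ≡ lift p y′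
  branching-unlift zero br = _ , _ , _ , br , refl , refl , refl
  branching-unlift (suc p) {w = root} br with branching-at-root br
  ... | zero , zero , _ , _ , _ , _ , i≢j = ⊥-elim (i≢j refl)
  branching-unlift (suc p) {w = child zero _} br with branching-at-child br
  ... | _ , _ , refl , refl , br′ with branching-unlift p br′
  ...   | w′ , x′ , y′ , br″ , refl , refl , refl = w′ , x′ , y′ , br″ , refl , refl , refl

  depth-stick≤ : ∀ p {t d} → (∀ (v : Vertex t) → depth v ≤ d) →
                 ∀ (v : Vertex (stick p t)) → depth v ≤ p + d
  depth-stick≤ zero    bound v              = bound v
  depth-stick≤ (suc p) bound root           = z≤n
  depth-stick≤ (suc p) bound (child zero v) = s≤s (depth-stick≤ p bound v)

  bottom : ∀ h → Vertex (path h)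
  bottom h = lift h root

  depth-bottom : ∀ h → depth (bottom h) ≡ h
  depth-bottom h = trans (depth-lift h root) (+-identityʳ h)

  depth-path≤ : ∀ h (v : Vertex (path h)) → depth v ≤ h
  depth-path≤ h v = subst (depth v ≤_) (+-identityʳ h) (depth-stick≤ h (λ { root → z≤n }) v)

  path-unbranched : ∀ h {w x y : Vertex (path h)} → ¬ Branching w x y
  path-unbranched h br with branching-unlift h br
  ... | root , _ , _ , br′ , _ with branching-at-root br′
  ...   | () , _

  fork-branching : ∀ {a b} {w x y : Vertex (fork a b)} → Branching w x y →
                   w ≡ root × (depth x ≤ suc b ⊎ depth y ≤ suc b)
  fork-branching {w = root} br with branching-at-root br
  ... | zero     , zero     , _  , _  , _    , _    , i≢j = ⊥-elim (i≢j refl)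
  ... | zero     , suc zero , _  , y′ , _    , refl , _   = refl , inj₂ (s≤s (depth-path≤ _ y′))
  ... | suc zero , zero     , x′ , _  , refl , _    , _   = refl , inj₁ (s≤s (depth-path≤ _ x′))
  ... | suc zero , suc zero , _  , _  , _    , _    , i≢j = ⊥-elim (i≢j refl)
  fork-branching {a} {w = child zero _} br with branching-at-child br
  ... | _ , _ , _ , _ , br′ = ⊥-elim (path-unbranched a br′)
  fork-branching {b = b} {w = child (suc zero) _} br with branching-at-child br
  ... | _ , _ , _ , _ , br′ = ⊥-elim (path-unbranched b br′)

  apex longTip shortTip : ∀ p b e → Vertex (yTree p b e)
  apex     p b e = lift p root
  longTip  p b e = lift p (child zero (bottom (b + e)))
  shortTip p b e = lift p (child (suc zero) (bottom b))

  yTree-branch : ∀ p b e → Branching (apex p b e) (longTip p b e) (shortTip p b e)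
  yTree-branch p b e = branching-lift p (branching-root (λ ()))

  depth-apex : ∀ p b e → depth (apex p b e) ≡ p
  depth-apex p b e = trans (depth-lift p root) (+-identityʳ p)

  depth-longTip : ∀ p b e → depth (longTip p b e) ≡ p + suc (b + e)
  depth-longTip p b e = trans (depth-lift p _) (cong (λ d → p + suc d) (depth-bottom (b + e)))

  depth-shortTip : ∀ p b e → depth (shortTip p b e) ≡ p + suc b
  depth-shortTip p b e = trans (depth-lift p _) (cong (λ d → p + suc d) (depth-bottom b))

  yTree-branching : ∀ p {b e} {w x y : Vertex (yTree p b e)} → Branching w x y →
                    depth w ≡ p × (depth x ≤ p + suc b ⊎ depth y ≤ p + suc b)
  yTree-branching p {b} {e} br with branching-unlift p br
  ... | _ , x′ , y′ , br′ , refl , refl , refl with fork-branching br′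
  ...   | refl , short = depth-apex p b e , ⊎-map (lifted x′) (lifted y′) short
    where
      lifted : ∀ {t} (v : Vertex t) {d} → depth v ≤ d → depth (lift p v) ≤ p + d
      lifted v v≤d = ≤-trans (≤-reflexive (depth-lift p v)) (+-monoʳ-≤ p v≤d)

  depth-yTree≤ : ∀ p b e (v : Vertex (yTree p b e)) → depth v ≤ p + suc (b + e)
  depth-yTree≤ p b e = depth-stick≤ p fork≤
    where
      fork≤ : ∀ (v : Vertex (fork (b + e) b)) → depth v ≤ suc (b + e)
      fork≤ root                  = z≤n
      fork≤ (child zero v)        = s≤s (depth-path≤ (b + e) v)
      fork≤ (child (suc zero) v)  = s≤s (≤-trans (depth-path≤ b v) (m≤m+n b e))

  data Binary : Tree → Set where
    binary₀ : Binary (node [])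
    binary₁ : ∀ {t} → Binary t → Binary (node (t ∷ []))
    binary₂ : ∀ {t u} → Binary t → Binary u → Binary (node (t ∷ u ∷ []))

  binary-child : ∀ {ts} → Binary (node ts) → (i : Fin (length ts)) → Binary (lookup ts i)
  binary-child (binary₁ bt)   zero       = bt
  binary-child (binary₂ bt _) zero       = bt
  binary-child (binary₂ _ bu) (suc zero) = bu

  binary-pigeonhole : ∀ {ts} → Binary (node ts) → (i j k : Fin (length ts)) → i ≢ j → j ≢ k → i ≢ k → ⊥
  binary-pigeonhole (binary₁ _)   zero       zero       _          i≢j _   _   = i≢j refl
  binary-pigeonhole (binary₂ _ _) zero       zero       _          i≢j _   _   = i≢j refl
  binary-pigeonhole (binary₂ _ _) (suc zero) (suc zero) _          i≢j _   _   = i≢j refl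
  binary-pigeonhole (binary₂ _ _) zero       (suc zero) zero       _   _   i≢k = i≢k refl
  binary-pigeonhole (binary₂ _ _) zero       (suc zero) (suc zero) _   j≢k _   = j≢k refl
  binary-pigeonhole (binary₂ _ _) (suc zero) zero       zero       _   j≢k _   = j≢k refl
  binary-pigeonhole (binary₂ _ _) (suc zero) zero       (suc zero) _   _   i≢k = i≢k refl

  binary-no-claw : ∀ {t} → Binary t → ∀ {w x y z : Vertex t} →
                   Branching w x y → Branching w y z → Branching w x z → ⊥
  binary-no-claw bt {root} bxy byz bxz
    with branching-at-root bxy | branching-at-root byz | branching-at-root bxz
  ... | i , j , _ , _ , refl , refl , i≢j | _ , k , _ , _ , refl , refl , j≢k | _ , _ , _ , _ , refl , refl , i≢k =
    binary-pigeonhole bt i j k i≢j j≢k i≢k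
  binary-no-claw bt {child i _} bxy byz bxz
    with branching-at-child bxy | branching-at-child byz | branching-at-child bxz
  ... | _ , _ , refl , refl , b₁ | _ , _ , refl , refl , b₂ | _ , _ , refl , refl , b₃ =
    binary-no-claw (binary-child bt i) b₁ b₂ b₃

  binary-stick : ∀ p {t} → Binary t → Binary (stick p t)
  binary-stick zero    bt = bt
  binary-stick (suc p) bt = binary₁ (binary-stick p bt)

  binary-path : ∀ h → Binary (path h)
  binary-path h = binary-stick h binary₀

  binary-yTree : ∀ p b e → Binary (yTree p b e)
  binary-yTree p b e = binary-stick p (binary₂ (binary-path (b + e)) (binary-path b))

  binary-doubleFork : Binary doubleFork
  binary-doubleFork = binary₂ (binary₂ binary₀ binary₀) binary₀

  claw≰binary : ∀ {t} → Binary t → ¬ (claw ≤ᵗ t)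
  claw≰binary bt E = binary-no-claw bt (legs {zero} {suc zero} (λ ())) (legs {suc zero} {suc (suc zero)} (λ ()))
                                       (legs {zero} {suc (suc zero)} (λ ()))
    where
      legs : ∀ {i j} → i ≢ j → Branching (f E root) (f E (child i (top _))) (f E (child j (top _)))
      legs i≢j = branching-image E (branching-root i≢j)

  SingleBranchLevel : Tree → Set
  SingleBranchLevel t = ∀ {w x y w′ x′ y′ : Vertex t} →
                        Branching w x y → Branching w′ x′ y′ → depth w ≡ depth w′

  path-singleBranchLevel : ∀ h → SingleBranchLevel (path h)
  path-singleBranchLevel h br = ⊥-elim (path-unbranched h br)

  yTree-singleBranchLevel : ∀ p b e → SingleBranchLevel (yTree p b e)
  yTree-singleBranchLevel p b e br br′ = trans (proj₁ (yTree-branching p br)) (sym (proj₁ (yTree-branching p br′)))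

  doubleFork≰ : ∀ {t} → SingleBranchLevel t → ¬ (doubleFork ≤ᵗ t)
  doubleFork≰ level E = <-irrefl (level (branching-image E upper) (branching-image E lower)) (depth-root<child E root)
    where
      upper : Branching {doubleFork} root (child zero (child zero root)) (child (suc zero) root)
      upper = branching-root (λ ())
      lower : Branching {doubleFork} (child zero root) (child zero (child zero root)) (child zero (child (suc zero) root))
      lower = branching-child (branching-root (λ ()))

  ≰-shallower : ∀ {t t′ d} (v : Vertex t) → (∀ (u : Vertex t′) → depth u ≤ d) →
                d < depth v → ¬ (t ≤ᵗ t′)
  ≰-shallower v bound d<v E = <⇒≱ d<v (≤-trans (depth-mono E v) (bound _))

  path≰path : ∀ {h h′} → h′ < h → ¬ (path h ≤ᵗ path h′)
  path≰path {h} {h′} h′<h =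
    ≰-shallower (bottom h) (depth-path≤ h′) (subst (h′ <_) (sym (depth-bottom h)) h′<h)

  yTree≰path : ∀ {p b e h} → ¬ (yTree p b e ≤ᵗ path h)
  yTree≰path {p} {b} {e} {h} E = path-unbranched h (branching-image E (yTree-branch p b e))

  yTree≰yTree-excess : ∀ {p b e e′} → e′ < e → ¬ (yTree p b e ≤ᵗ yTree p b e′)
  yTree≰yTree-excess {p} {b} {e} {e′} e′<e =
    ≰-shallower (longTip p b e) (depth-yTree≤ p b e′)
                (subst (_ <_) (sym (depth-longTip p b e)) (+-monoʳ-< p (s≤s (+-monoʳ-< b e′<e))))

  yTree≰yTree-stem : ∀ {p b e p′ b′ e′} → p′ < p → ¬ (yTree p b e ≤ᵗ yTree p′ b′ e′)
  yTree≰yTree-stem {p} {b} {e} {p′} p′<p E = <⇒≱ p′<p (begin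
    p                          ≡⟨ depth-apex p b e ⟨
    depth (apex p b e)         ≤⟨ depth-mono E (apex p b e) ⟩
    depth (f E (apex p b e))   ≡⟨ proj₁ (yTree-branching p′ (branching-image E (yTree-branch p b e))) ⟩
    p′                         ∎)
    where open ≤-Reasoning

  -- Both arms of the branch of yTree p b e reach at least suc b below its apex; depth-gap
  -- transports this to the image branch, one of whose arms is only suc b′ long.
  yTree≰yTree-arm : ∀ {p b e p′ b′ e′} → b′ < b → ¬ (yTree p b e ≤ᵗ yTree p′ b′ e′)
  yTree≰yTree-arm {p} {b} {e} {p′} {b′} b′<b E = [ too-long long , too-long short ]′ (proj₂ image)
    where
      w = apex p b e
      branch = yTree-branch p b e
      image = yTree-branching p′ (branching-image E branch)

      long : w ≼ longTip p b e × depth w + suc b ≤ depth (longTip p b e)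
      long = proj₁ (proj₁ branch) ,
             subst₂ _≤_ (cong (_+ suc b) (sym (depth-apex p b e))) (sym (depth-longTip p b e))
                    (+-monoʳ-≤ p (s≤s (m≤m+n b e)))

      short : w ≼ shortTip p b e × depth w + suc b ≤ depth (shortTip p b e)
      short = proj₁ (proj₂ (proj₁ branch)) ,
              ≤-reflexive (trans (cong (_+ suc b) (depth-apex p b e)) (sym (depth-shortTip p b e)))

      too-long : ∀ {v} → w ≼ v × depth w + suc b ≤ depth v → ¬ (depth (f E v) ≤ p′ + suc b′)
      too-long {v} (w≼v , far) fv≤ = <⇒≱ (s≤s b′<b) (+-cancelˡ-≤ p′ _ _ (begin
        p′ + suc b             ≡⟨ cong (_+ suc b) (proj₁ image) ⟨
        depth (f E w) + suc b  ≤⟨ depth-gap E w≼v far ⟩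
        depth (f E v)          ≤⟨ fv≤ ⟩
        p′ + suc b′            ∎))
        where open ≤-Reasoning

module BadSequence where
  open import Level using (0ℓ)
  open import Data.Nat using (ℕ; zero; suc; _+_; _∸_; _≤_; _<_; _<?_; ⌊_/2⌋; ⌈_/2⌉; z≤n; s≤s)
  open import Data.Nat.Properties
  open import Data.Nat.Tactic.RingSolver using (solve-∀)
  open import Data.Sum using (inj₁; inj₂)
  open import Data.Empty using (⊥-elim)
  open import Relation.Nullary using (¬_; yes; no)
  open import Function using (_∘_)
  open import Relation.Unary using (Pred; _∪_; _⊆_; U)
  open import Relation.Binary.PropositionalEquality
  open NonEmbedding

  size-stick : ∀ p t → size (stick p t) ≡ p + size t
  size-stick zero    t = refl
  size-stick (suc p) t = cong suc (trans (+-identityʳ _) (size-stick p t))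

  size-path : ∀ h → size (path h) ≡ suc h
  size-path h = trans (size-stick h _) (+-comm h 1)

  size-yTree : ∀ p b e → size (yTree p b e) ≡ p + (b + b) + e + 3
  size-yTree p b e = begin
    size (yTree p b e)                                   ≡⟨ size-stick p _ ⟩
    p + suc (size (path (b + e)) + (size (path b) + 0))  ≡⟨ cong₂ (λ l s → p + suc (l + (s + 0)))
                                                                   (size-path (b + e)) (size-path b) ⟩
    p + suc (suc (b + e) + (suc b + 0))                  ≡⟨ rearrange p b e ⟩
    p + (b + b) + e + 3                                  ∎
    where
      open ≡-Reasoning
      rearrange : ∀ p b e → p + suc (suc (b + e) + (suc b + 0)) ≡ p + (b + b) + e + 3
      rearrange = solve-∀

  record Seq : Set where
    field
      len : ℕ
      at  : ℕ → Tree
  open Seq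

  _++_ : Seq → Seq → Seq
  len (σ ++ τ) = len σ + len τ
  at (σ ++ τ) n with n <? len σ
  ... | yes _ = at σ n
  ... | no _  = at τ (n ∸ len σ)

  -- σ occupies the positions s, s + 1, … of the final sequence, and all its trees satisfy A.
  record Admissible (s : ℕ) (A : Pred Tree 0ℓ) (σ : Seq) : Set where
    field
      shape : ∀ {n} → n < len σ → A (at σ n)
      small : ∀ {n} → n < len σ → size (at σ n) ≤ suc (s + n) + 3
      bad   : ∀ {m n} → m < n → n < len σ → ¬ (at σ m ≤ᵗ at σ n)
  open Admissible

  admissible-⊆ : ∀ {s A B σ} → A ⊆ B → Admissible s A σ → Admissible s B σ
  admissible-⊆ A⊆B adm = record { shape = A⊆B ∘ shape adm ; small = small adm ; bad = bad adm }

  ++-admissible : ∀ {s A B σ τ} → Admissible s A σ → Admissible (s + len σ) B τ →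
                  (∀ {t t′} → A t → B t′ → ¬ (t ≤ᵗ t′)) → Admissible s (A ∪ B) (σ ++ τ)
  ++-admissible {s} {A} {B} {σ} {τ} adm₁ adm₂ A≰B = record { shape = shape′ ; small = small′ ; bad = bad′ }
    where
      in-τ : ∀ {n} → n < len σ + len τ → ¬ n < len σ → n ∸ len σ < len τ
      in-τ n< n≮σ = +-cancelˡ-< (len σ) _ _ (subst (_< len σ + len τ) (sym (m+[n∸m]≡n (≮⇒≥ n≮σ))) n<)

      shape′ : ∀ {n} → n < len (σ ++ τ) → (A ∪ B) (at (σ ++ τ) n)
      shape′ {n} n< with n <? len σ
      ... | yes n<σ = inj₁ (shape adm₁ n<σ)
      ... | no  n≮σ = inj₂ (shape adm₂ (in-τ n< n≮σ))

      small′ : ∀ {n} → n < len (σ ++ τ) → size (at (σ ++ τ) n) ≤ suc (s + n) + 3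
      small′ {n} n< with n <? len σ
      ... | yes n<σ = small adm₁ n<σ
      ... | no  n≮σ = subst (λ k → size (at τ (n ∸ len σ)) ≤ suc k + 3)
                        (trans (+-assoc s _ _) (cong (s +_) (m+[n∸m]≡n (≮⇒≥ n≮σ))))
                        (small adm₂ (in-τ n< n≮σ))

      bad′ : ∀ {m n} → m < n → n < len (σ ++ τ) → ¬ (at (σ ++ τ) m ≤ᵗ at (σ ++ τ) n)
      bad′ {m} {n} m<n n< with m <? len σ | n <? len σ
      ... | yes _   | yes n<σ = bad adm₁ m<n n<σ
      ... | yes m<σ | no  n≮σ = A≰B (shape adm₁ m<σ) (shape adm₂ (in-τ n< n≮σ))
      ... | no  m≮σ | yes n<σ = ⊥-elim (m≮σ (<-trans m<n n<σ))
      ... | no  m≮σ | no  n≮σ = bad adm₂ (∸-monoˡ-< m<n (≮⇒≥ m≮σ)) (in-τ n< n≮σ)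

  single : Tree → Seq
  single t = record { len = 1 ; at = λ _ → t }

  single-admissible : ∀ {s t} → size t ≤ suc s + 3 → Admissible s (_≡ t) (single t)
  single-admissible {s} {t} fits = record { shape = λ _ → refl ; small = small′ ; bad = bad′ }
    where
      small′ : ∀ {n} → n < 1 → size t ≤ suc (s + n) + 3
      small′ (s≤s z≤n) = subst (λ k → size t ≤ suc k + 3) (sym (+-identityʳ s)) fits
      bad′ : ∀ {m n} → m < n → n < 1 → ¬ (t ≤ᵗ t)
      bad′ m<n (s≤s z≤n) = ⊥-elim (n≮0 m<n)

  data IsYTree (P B : Pred ℕ 0ℓ) : Pred Tree 0ℓ where
    yTree∈ : ∀ {p b e} → P p → B b → IsYTree P B (yTree p b e)

  data IsPath : Pred Tree 0ℓ where
    path∈ : ∀ h → IsPath (path h)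

  -- The largest e such that yTree p b e may stand at position s (when p + (b + b) ≤ suc s).
  maxExcess : ℕ → ℕ → ℕ → ℕ
  maxExcess p b s = suc s ∸ (p + (b + b))

  block : ℕ → ℕ → ℕ → Seq
  block p b s = record { len = suc (maxExcess p b s) ; at = λ n → yTree p b (maxExcess p b s ∸ n) }

  block-admissible : ∀ p b s → p + (b + b) ≤ suc s → Admissible s (IsYTree (_≡ p) (_≡ b)) (block p b s)
  block-admissible p b s fits = record { shape = λ _ → yTree∈ refl refl ; small = small′ ; bad = bad′ }
    where
      E = maxExcess p b s
      small′ : ∀ {n} → n < suc E → size (yTree p b (E ∸ n)) ≤ suc (s + n) + 3
      small′ {n} _ = begin
        size (yTree p b (E ∸ n))   ≡⟨ size-yTree p b _ ⟩
        p + (b + b) + (E ∸ n) + 3  ≤⟨ +-monoˡ-≤ 3 (+-monoʳ-≤ (p + (b + b)) (m∸n≤m E n)) ⟩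
        p + (b + b) + E + 3        ≡⟨ cong (_+ 3) (m+[n∸m]≡n fits) ⟩
        suc s + 3                  ≤⟨ +-monoˡ-≤ 3 (s≤s (m≤m+n s n)) ⟩
        suc (s + n) + 3            ∎
        where open ≤-Reasoning
      bad′ : ∀ {m n} → m < n → n < suc E → ¬ (yTree p b (E ∸ m) ≤ᵗ yTree p b (E ∸ n))
      bad′ m<n n≤E = yTree≰yTree-excess (∸-monoʳ-< m<n (≤-pred n≤E))

  blocks : ℕ → ℕ → ℕ → Seq
  blocks p zero    s = block p zero s
  blocks p (suc b) s = block p (suc b) s ++ blocks p b (s + len (block p (suc b) s))

  blocks-admissible : ∀ p b s → p + (b + b) ≤ suc s → Admissible s (IsYTree (_≡ p) (_≤ b)) (blocks p b s)
  blocks-admissible p zero s fits =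
    admissible-⊆ (λ { (yTree∈ p≡ refl) → yTree∈ p≡ z≤n }) (block-admissible p zero s fits)
  blocks-admissible p (suc b) s fits =
    admissible-⊆ merge (++-admissible (block-admissible p (suc b) s fits)
                                      (blocks-admissible p b _ fits′) shorter)
    where
      fits′ : p + (b + b) ≤ suc (s + len (block p (suc b) s))
      fits′ = ≤-trans (+-monoʳ-≤ p (+-mono-≤ (n≤1+n b) (n≤1+n b))) (≤-trans fits (s≤s (m≤m+n s _)))
      shorter : ∀ {t t′} → IsYTree (_≡ p) (_≡ suc b) t → IsYTree (_≡ p) (_≤ b) t′ → ¬ (t ≤ᵗ t′)
      shorter (yTree∈ _ refl) (yTree∈ _ b′≤b) = yTree≰yTree-arm (s≤s b′≤b)
      merge : IsYTree (_≡ p) (_≡ suc b) ∪ IsYTree (_≡ p) (_≤ b) ⊆ IsYTree (_≡ p) (_≤ suc b)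
      merge (inj₁ (yTree∈ p≡ refl)) = yTree∈ p≡ ≤-refl
      merge (inj₂ (yTree∈ p≡ b′≤b)) = yTree∈ p≡ (m≤n⇒m≤1+n b′≤b)

  -- The largest b such that yTree p b 0 may stand at position s (when p ≤ suc s).
  maxArm : ℕ → ℕ → ℕ
  maxArm p s = ⌊ suc s ∸ p /2⌋

  maxArm-fits : ∀ {p s} → p ≤ suc s → p + (maxArm p s + maxArm p s) ≤ suc s
  maxArm-fits {p} {s} p≤s = begin
    p + (⌊ r /2⌋ + ⌊ r /2⌋)  ≤⟨ +-monoʳ-≤ p (+-monoʳ-≤ ⌊ r /2⌋ (⌊n/2⌋≤⌈n/2⌉ r)) ⟩
    p + (⌊ r /2⌋ + ⌈ r /2⌉)  ≡⟨ cong (p +_) (⌊n/2⌋+⌈n/2⌉≡n r) ⟩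
    p + r                    ≡⟨ m+[n∸m]≡n p≤s ⟩
    suc s                    ∎
    where
      open ≤-Reasoning
      r = suc s ∸ p

  levels : ℕ → ℕ → Seq
  levels zero    s = blocks zero (maxArm zero s) s
  levels (suc p) s = first ++ levels p (s + len first)
    where first = blocks (suc p) (maxArm (suc p) s) s

  levels-admissible : ∀ p s → p ≤ suc s → Admissible s (IsYTree (_≤ p) U) (levels p s)
  levels-admissible zero s _ =
    admissible-⊆ (λ { (yTree∈ refl _) → yTree∈ z≤n _ })
                 (blocks-admissible zero (maxArm zero s) s (maxArm-fits z≤n))
  levels-admissible (suc p) s fits =
    admissible-⊆ merge (++-admissible (blocks-admissible (suc p) _ s (maxArm-fits fits))
                                      (levels-admissible p _ fits′) lower)
    where
      fits′ : p ≤ suc (s + len (blocks (suc p) (maxArm (suc p) s) s))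
      fits′ = ≤-trans (n≤1+n p) (≤-trans fits (s≤s (m≤m+n s _)))
      lower : ∀ {t t′} → IsYTree (_≡ suc p) (_≤ maxArm (suc p) s) t → IsYTree (_≤ p) U t′ → ¬ (t ≤ᵗ t′)
      lower (yTree∈ refl _) (yTree∈ p′≤p _) = yTree≰yTree-stem (s≤s p′≤p)
      merge : IsYTree (_≡ suc p) (_≤ maxArm (suc p) s) ∪ IsYTree (_≤ p) U ⊆ IsYTree (_≤ suc p) U
      merge (inj₁ (yTree∈ refl _))  = yTree∈ ≤-refl _
      merge (inj₂ (yTree∈ p′≤p _)) = yTree∈ (m≤n⇒m≤1+n p′≤p) _

  paths : ℕ → Seq
  paths s = record { len = suc (s + 3) ; at = λ n → path (s + 3 ∸ n) }

  paths-admissible : ∀ s → Admissible s IsPath (paths s)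
  paths-admissible s = record { shape = λ _ → path∈ _ ; small = small′ ; bad = bad′ }
    where
      small′ : ∀ {n} → n < suc (s + 3) → size (path (s + 3 ∸ n)) ≤ suc (s + n) + 3
      small′ {n} _ = begin
        size (path (s + 3 ∸ n))  ≡⟨ size-path _ ⟩
        suc (s + 3 ∸ n)          ≤⟨ s≤s (m∸n≤m (s + 3) n) ⟩
        suc (s + 3)              ≤⟨ s≤s (+-monoˡ-≤ 3 (m≤m+n s n)) ⟩
        suc (s + n) + 3          ∎
        where open ≤-Reasoning
      bad′ : ∀ {m n} → m < n → n < suc (s + 3) → ¬ (path (s + 3 ∸ m) ≤ᵗ path (s + 3 ∸ n))
      bad′ m<n n≤ = path≰path (∸-monoʳ-< m<n (≤-pred n≤))

  binary-doubleFork-yTree-path : ∀ {P B} → (_≡ doubleFork) ∪ (IsYTree P B ∪ IsPath) ⊆ Binary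
  binary-doubleFork-yTree-path (inj₁ refl)                            = binary-doubleFork
  binary-doubleFork-yTree-path (inj₂ (inj₁ (yTree∈ {p} {b} {e} _ _))) = binary-yTree p b e
  binary-doubleFork-yTree-path (inj₂ (inj₂ (path∈ h)))                = binary-path h

  singleBranchLevel-yTree-path : ∀ {P B} → IsYTree P B ∪ IsPath ⊆ SingleBranchLevel
  singleBranchLevel-yTree-path (inj₁ (yTree∈ {p} {b} {e} _ _)) = yTree-singleBranchLevel p b e
  singleBranchLevel-yTree-path (inj₂ (path∈ h))                = path-singleBranchLevel h

  yTreesThenPaths : ℕ → ℕ → Seq
  yTreesThenPaths p s = levels p s ++ paths (s + len (levels p s))

  yTreesThenPaths-admissible : ∀ p s → p ≤ suc s → Admissible s (IsYTree (_≤ p) U ∪ IsPath) (yTreesThenPaths p s)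
  yTreesThenPaths-admissible p s fits =
    ++-admissible (levels-admissible p s fits) (paths-admissible _) λ { (yTree∈ _ _) (path∈ _) → yTree≰path }

  sequence : Seq
  sequence = single claw ++ (single doubleFork ++ yTreesThenPaths 3 2)

  sequence-admissible : Admissible 0 U sequence
  sequence-admissible =
    admissible-⊆ _ (++-admissible (single-admissible ≤-refl)
                     (++-admissible (single-admissible ≤-refl) (yTreesThenPaths-admissible 3 2 ≤-refl)
                       λ { refl t∈ → doubleFork≰ (singleBranchLevel-yTree-path t∈) })
                     λ { refl t∈ → claw≰binary (binary-doubleFork-yTree-path t∈) })

open import Data.Nat using (ℕ; suc; _+_; _*_; _∸_; _^_; _≤_; _≥_)
open import Data.Nat.Properties using (≤ᵇ⇒≤)
open import Data.Fin using (Fin; toℕ; _<_)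
open import Data.Fin.Properties using (toℕ<n)
open import Data.Product using (Σ; _×_; _,_)
open import Relation.Nullary using (¬_)
open BadSequence using (sequence; sequence-admissible; module Seq; module Admissible)

theorem4p1 : Σ ℕ λ m → (m ≥ 3 * 2 ^ 48 ∸ 8) × Σ (Fin m → Tree) λ T →
    (∀ (k : Fin m) → size (T k) ≤ suc (toℕ k) + 3) ×
    (∀ (i j : Fin m) → i < j → ¬ (T i ≤ᵗ T j))
theorem4p1 =
  len sequence , ≤ᵇ⇒≤ (3 * 2 ^ 48 ∸ 8) (len sequence) _ , (λ k → at sequence (toℕ k)) ,
  (λ k → small sequence-admissible (toℕ<n k)) , (λ i j i<j → bad sequence-admissible i<j (toℕ<n j))
  where
    open Seq
    open Admissible
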